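{- Let $G$ be a bipartite graph with $n(G)$ vertices. Then $\mathrm{m}(G)\leq 2+\log_2 n(G)$.
   Context: All graphs are finite, simple and undirected, with at least one vertex. A $k$-list assignment $L$ to $G$ assigns to each vertex $v$ a set $L(v)$ of exactly $k$ colors; an $L$-coloring is a proper coloring $c$ with $c(v)\in L(v)$ for all $v$. $G$ is uniquely $k$-list colorable if some $k$-list assignment $L$ admits exactly one $L$-coloring of $G$. The m-number $\mathrm{m}(G)$ is the minimum positive integer $k$ such that $G$ is not uniquely $k$-list colorable. -}

module Defs where

open import Data.Nat using (ℕ; suc; _≤_; _+_)
open import Data.Nat.Logarithm using (⌊log₂_⌋)
open import Data.Fin using (Fin)
open import Data.Bool using (Bool; true; false)
open import Data.List using (List; length)
open import Data.List.Relation.Unary.Unique.Propositional using (Unique)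
open import Data.List.Membership.Propositional using (_∈_)
open import Data.Product using (Σ; ∃; _×_; _,_)
open import Relation.Nullary using (¬_)
open import Relation.Binary.PropositionalEquality using (_≡_; _≢_)

record Graph : Set where
  field
    n      : ℕ
    n≥1    : 1 ≤ n
    adj    : Fin n → Fin n → Bool
    sym    : ∀ u v → adj u v ≡ adj v u
    irrefl : ∀ v → adj v v ≡ false
open Graph public

nv : Graph → ℕ
nv G = n G

Adj : (G : Graph) → Fin (n G) → Fin (n G) → Set
Adj G u v = adj G u v ≡ true

Bipartite : Graph → Set
Bipartite G = Σ (Fin (n G) → Bool) λ side →
  ∀ u v → Adj G u v → side u ≢ side v

record ListAssignment (G : Graph) (k : ℕ) : Set where
  field
    L      : Fin (n G) → List ℕ
    unique : ∀ v → Unique (L v)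
    size   : ∀ v → length (L v) ≡ k
open ListAssignment public

IsLColoring : {G : Graph} {k : ℕ} → ListAssignment G k → (Fin (n G) → ℕ) → Set
IsLColoring {G} La c =
  (∀ v → c v ∈ L La v) × (∀ u v → Adj G u v → c u ≢ c v)

UniqueLColoring : {G : Graph} {k : ℕ} → ListAssignment G k → Set
UniqueLColoring {G} La = Σ (Fin (n G) → ℕ) λ c →
  IsLColoring La c × (∀ c′ → IsLColoring La c′ → ∀ v → c′ v ≡ c v)

UniquelyListColorable : Graph → ℕ → Set
UniquelyListColorable G k = Σ (ListAssignment G k) UniqueLColoring

-- m(G) ≤ b: since m(G) is the least positive k such that G is not uniquely
-- k-list colourable, m(G) ≤ b iff some positive k ≤ b has this property.
MNumberAtMost : Graph → ℕ → Set
MNumberAtMost G b = ∃ λ k → 1 ≤ k × k ≤ b × ¬ UniquelyListColorable G k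

{-# OPTIONS --safe #-}
module Submission where

-- Let c₀ be an L-colouring, all lists having k = 2 + ⌊log₂ n⌋ colours, and delete c₀(v) from
-- each list.  For a uniformly random S : colours → Bool, the probability that S avoids the
-- value side(v) on the shortened list of v is 2^(1-k), and n < 2^(k-1); so some S takes the
-- value side(v) on every shortened list, and the method of conditional expectations
-- (Erdős–Selfridge) finds it.  Choosing such a colour at every vertex gives a proper
-- L-colouring, since adjacent vertices lie on different sides, and it differs from c₀ everywhere.

open import Defs hiding (sym)
open import Data.Nat using (_+_)
open import Data.Nat.Logarithm using (⌊log₂_⌋)

import Algebra.Properties.Monoid.Sum
open import Data.Bool using (Bool; true; false)
import Data.Bool as Bool
open import Data.Fin using (Fin; zero; suc; fromℕ<)
open import Data.List using (List; []; _∷_; length; filter; concatMap; allFin)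
open import Data.List.Membership.Propositional using (_∈_; lose)
open import Data.List.Membership.Propositional.Properties using (∈-filter⁻; ∈-concatMap⁺; ∈-allFin)
open import Data.List.Properties using (filter-accept; filter-reject; filter-all)
open import Data.List.Relation.Binary.Subset.Propositional using (_⊆_)
import Data.List.Relation.Unary.All as All
import Data.List.Relation.Unary.Any as Any
open import Data.List.Relation.Unary.Any using (here; there)
open import Data.List.Relation.Unary.Unique.Propositional using (Unique; _∷_)
import Data.List.Relation.Unary.Unique.Propositional.Properties as Unique
open import Data.Maybe using (Maybe; just; nothing; maybe)
import Data.Maybe.Relation.Unary.All as Maybe
open import Data.Maybe.Relation.Unary.All using (just; nothing)
open import Data.Nat using (ℕ; zero; suc; _*_; _∸_; _^_; _≤_; _<_; z≤n; s≤s)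
open import Data.Nat.Logarithm using (⌊log₂⌋-mono-≤; ⌊log₂[2^n]⌋≡n)
open import Data.Nat.Properties
open import Algebra.Properties.CommutativeSemigroup +-commutativeSemigroup using (interchange)
open import Data.Product using (_×_; _,_; proj₁; proj₂; ∃-syntax)
open import Data.Sum using (_⊎_; inj₁; inj₂; [_,_]′)
open import Function using (_∘_)
open import Relation.Binary.Definitions using (DecidableEquality)
open import Relation.Binary.PropositionalEquality
  using (_≡_; _≢_; refl; sym; trans; cong; subst; ≢-sym; module ≡-Reasoning)
open import Relation.Nullary using (¬_; yes; no; ¬?; contradiction)

open Algebra.Properties.Monoid.Sum +-0-monoid using (sum; sum-syntax; sum-cong-≗)

sum-const : ∀ m c → ∑[ i < m ] c ≡ m * c
sum-const zero    c = refl
sum-const (suc m) c = cong (c +_) (sum-const m c)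

sum-+ : ∀ {m} (f g : Fin m → ℕ) → ∑[ i < m ] (f i + g i) ≡ sum f + sum g
sum-+ {zero}  f g = refl
sum-+ {suc m} f g = begin
  f zero + g zero + ∑[ i < m ] (f (suc i) + g (suc i))
    ≡⟨ cong (f zero + g zero +_) (sum-+ (f ∘ suc) (g ∘ suc)) ⟩
  f zero + g zero + (sum (f ∘ suc) + sum (g ∘ suc))
    ≡⟨ interchange (f zero) (g zero) (sum (f ∘ suc)) (sum (g ∘ suc)) ⟩
  f zero + sum (f ∘ suc) + (g zero + sum (g ∘ suc)) ∎
  where open ≡-Reasoning

sum-mono-≤ : ∀ {m} {f g : Fin m → ℕ} → (∀ i → f i ≤ g i) → sum f ≤ sum g
sum-mono-≤ {zero}  f≤g = z≤n
sum-mono-≤ {suc m} f≤g = +-mono-≤ (f≤g zero) (sum-mono-≤ (f≤g ∘ suc))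

sum-lookup-≤ : ∀ {m} (f : Fin m → ℕ) i → f i ≤ sum f
sum-lookup-≤ f zero    = m≤m+n (f zero) _
sum-lookup-≤ f (suc i) = ≤-trans (sum-lookup-≤ (f ∘ suc) i) (m≤n+m _ (f zero))

2^[m∸n]≤2*2^[m∸1+n] : ∀ m n → 2 ^ (m ∸ n) ≤ 2 * 2 ^ (m ∸ suc n)
2^[m∸n]≤2*2^[m∸1+n] zero    zero    = s≤s z≤n
2^[m∸n]≤2*2^[m∸1+n] zero    (suc n) = s≤s z≤n
2^[m∸n]≤2*2^[m∸1+n] (suc m) zero    = ≤-refl
2^[m∸n]≤2*2^[m∸1+n] (suc m) (suc n) = 2^[m∸n]≤2*2^[m∸1+n] m n

n<2^[1+⌊log₂n⌋] : ∀ n → n < 2 ^ suc ⌊log₂ n ⌋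
n<2^[1+⌊log₂n⌋] n = ≰⇒> λ 2^[1+⌊log₂n⌋]≤n →
  1+n≰n (subst (_≤ ⌊log₂ n ⌋) (⌊log₂[2^n]⌋≡n (suc ⌊log₂ n ⌋)) (⌊log₂⌋-mono-≤ 2^[1+⌊log₂n⌋]≤n))

m+n<o+o⇒m<o⊎n<o : ∀ {m n o} → m + n < o + o → m < o ⊎ n < o
m+n<o+o⇒m<o⊎n<o {m} {n} {o} m+n<o+o with m <? o
... | yes m<o = inj₁ m<o
... | no  m≮o = inj₂ (+-cancelˡ-< o n o (≤-<-trans (+-monoˡ-≤ n (≮⇒≥ m≮o)) m+n<o+o))

module Removal {A : Set} (_≟_ : DecidableEquality A) where

  remove : A → List A → List A
  remove x = filter (λ y → ¬? (y ≟ x))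

  ∈-remove⁻ : ∀ {x y C} → y ∈ remove x C → y ∈ C × y ≢ x
  ∈-remove⁻ {x} = ∈-filter⁻ (λ y → ¬? (y ≟ x))

  length-remove : ∀ {x C} → Unique C → x ∈ C → length C ≡ suc (length (remove x C))
  length-remove {x} {x ∷ C} (x∉C ∷ _) (here refl) = cong (suc ∘ length) (sym (begin
    remove x (x ∷ C) ≡⟨ filter-reject (λ y → ¬? (y ≟ x)) (λ x≢x → x≢x refl) ⟩
    remove x C       ≡⟨ filter-all (λ y → ¬? (y ≟ x)) (All.map ≢-sym x∉C) ⟩
    C                ∎))
    where open ≡-Reasoning
  length-remove {x} {y ∷ C} (y∉C ∷ uC) (there x∈C) = cong suc (begin
    length C                          ≡⟨ length-remove uC x∈C ⟩
    suc (length (remove x C))         ≡⟨ cong length (filter-accept (λ z → ¬? (z ≟ x)) y≢x) ⟨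
    length (remove x (y ∷ C))         ∎)
    where
    open ≡-Reasoning
    y≢x : y ≢ x
    y≢x = All.lookup y∉C x∈C

module Hitting {A : Set} (_≟_ : DecidableEquality A) where

  open Removal _≟_
  open import Data.List.Membership.DecPropositional _≟_ using (_∈?_)

  Hit : (A → Bool) → Bool → List A → Set
  Hit S b C = ∃[ y ] y ∈ C × S y ≡ b

  Within : List A → List A → Set
  Within V C = Unique C × C ⊆ V

  -- For |C| ≤ K, 2^K times the probability that a uniformly random assignment misses C.
  weight : ℕ → Maybe (List A) → ℕ
  weight K = maybe (λ C → 2 ^ (K ∸ length C)) 0

  _[_≔_] : (A → Bool) → A → Bool → A → Bool
  (S [ x ≔ β ]) y with y ≟ x
  ... | yes _ = β
  ... | no  _ = S y

  [≔]-updates : ∀ S x β → (S [ x ≔ β ]) x ≡ β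
  [≔]-updates S x β with x ≟ x
  ... | yes _   = refl
  ... | no  x≢x = contradiction refl x≢x

  [≔]-minimal : ∀ S {x y} β → y ≢ x → (S [ x ≔ β ]) y ≡ S y
  [≔]-minimal S {x} {y} β y≢x with y ≟ x
  ... | yes y≡x = contradiction y≡x y≢x
  ... | no  _   = refl

  -- The clause with target b after setting x to β: nothing once it is hit, otherwise the
  -- part of it that can still be hit.
  restrict : A → Bool → Bool → Maybe (List A) → Maybe (List A)
  restrict x β b nothing = nothing
  restrict x β b (just C) with x ∈? C | β Bool.≟ b
  ... | no  _ | _     = just C
  ... | yes _ | yes _ = nothing
  ... | yes _ | no  _ = just (remove x C)

  restrict-sound : ∀ {S x β b} s → Maybe.All (Hit S b) (restrict x β b s) → Maybe.All (Hit (S [ x ≔ β ]) b) s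
  restrict-sound nothing _ = nothing
  restrict-sound {S} {x} {β} {b} (just C) hit with x ∈? C | β Bool.≟ b | hit
  ... | no x∉C | _ | just (y , y∈C , Sy≡b) =
    just (y , y∈C , trans ([≔]-minimal S β λ { refl → x∉C y∈C }) Sy≡b)
  ... | yes x∈C | yes β≡b | nothing = just (x , x∈C , trans ([≔]-updates S x β) β≡b)
  ... | yes _ | no _ | just (y , y∈C-x , Sy≡b) =
    let y∈C , y≢x = ∈-remove⁻ y∈C-x in just (y , y∈C , trans ([≔]-minimal S β y≢x) Sy≡b)

  restrict-within : ∀ {x V β b} s → Maybe.All (Within (x ∷ V)) s → Maybe.All (Within V) (restrict x β b s)
  restrict-within nothing _ = nothing
  restrict-within {x} {V} {β} {b} (just C) (just (uC , C⊆x∷V)) with x ∈? C | β Bool.≟ b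
  ... | no x∉C | _ = just (uC , λ y∈C → Any.tail (λ { refl → x∉C y∈C }) (C⊆x∷V y∈C))
  ... | yes _ | yes _ = nothing
  ... | yes _ | no _ = just (Unique.filter⁺ _ uC , λ y∈C-x →
    let y∈C , y≢x = ∈-remove⁻ y∈C-x in Any.tail y≢x (C⊆x∷V y∈C))

  weight-remove : ∀ K {x C} → Unique C → x ∈ C →
    2 ^ (K ∸ length (remove x C)) ≤ 2 ^ (K ∸ length C) + 2 ^ (K ∸ length C)
  weight-remove K {x} {C} uC x∈C = begin
    2 ^ (K ∸ length (remove x C))         ≤⟨ 2^[m∸n]≤2*2^[m∸1+n] K (length (remove x C)) ⟩
    2 * 2 ^ (K ∸ suc (length (remove x C))) ≡⟨ cong (λ l → 2 * 2 ^ (K ∸ l)) (length-remove uC x∈C) ⟨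
    2 * 2 ^ (K ∸ length C)                ≡⟨ cong (2 ^ (K ∸ length C) +_) (+-identityʳ _) ⟩
    2 ^ (K ∸ length C) + 2 ^ (K ∸ length C) ∎
    where open ≤-Reasoning

  restrict-weight : ∀ K x b s → Maybe.All Unique s →
    weight K (restrict x true b s) + weight K (restrict x false b s) ≤ weight K s + weight K s
  restrict-weight K x b nothing _ = z≤n
  restrict-weight K x b (just C) (just uC) with x ∈? C | b
  ... | no _    | _     = ≤-refl
  ... | yes x∈C | true  = weight-remove K uC x∈C
  ... | yes x∈C | false = ≤-trans (≤-reflexive (+-identityʳ _)) (weight-remove K uC x∈C)

  hitting-assignment : ∀ K V {m} (b : Fin m → Bool) (C : Fin m → Maybe (List A)) →
    (∀ i → Maybe.All (Within V) (C i)) → ∑[ i < m ] weight K (C i) < 2 ^ K →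
    ∃[ S ] ∀ i → Maybe.All (Hit S (b i)) (C i)
  hitting-assignment K [] b C within light =
    (λ _ → true) , λ i → hit (within i) (≤-<-trans (sum-lookup-≤ (weight K ∘ C) i) light)
    where
    hit : ∀ {S b s} → Maybe.All (Within []) s → weight K s < 2 ^ K → Maybe.All (Hit S b) s
    hit nothing                   _     = nothing
    hit (just {[]} _)             light = contradiction light (<-irrefl refl)
    hit (just {_ ∷ _} (_ , C⊆[])) _     = contradiction (C⊆[] (here refl)) λ ()
  hitting-assignment K (x ∷ V) b C within light =
    [ extend true , extend false ]′ (m+n<o+o⇒m<o⊎n<o light-true+false)
    where
    weight-after : Bool → Fin _ → ℕ
    weight-after β i = weight K (restrict x β (b i) (C i))
    weight-before : Fin _ → ℕ
    weight-before i = weight K (C i)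
    light-true+false : sum (weight-after true) + sum (weight-after false) < 2 ^ K + 2 ^ K
    light-true+false = begin-strict
      sum (weight-after true) + sum (weight-after false)
        ≡⟨ sum-+ (weight-after true) (weight-after false) ⟨
      ∑[ i < _ ] (weight-after true i + weight-after false i)
        ≤⟨ sum-mono-≤ (λ i → restrict-weight K x (b i) (C i) (Maybe.map proj₁ (within i))) ⟩
      ∑[ i < _ ] (weight-before i + weight-before i)
        ≡⟨ sum-+ weight-before weight-before ⟩
      sum weight-before + sum weight-before
        <⟨ +-mono-< light light ⟩
      2 ^ K + 2 ^ K ∎
      where open ≤-Reasoning
    extend : ∀ β → sum (weight-after β) < 2 ^ K →
      ∃[ S ] ∀ i → Maybe.All (Hit S (b i)) (C i)
    extend β light-β =
      let S , hits = hitting-assignment K V b (λ i → restrict x β (b i) (C i))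
                       (λ i → restrict-within (C i) (within i)) light-β
      in S [ x ≔ β ] , λ i → restrict-sound (C i) (hits i)

open Removal _≟_
open Hitting _≟_

coloring-avoiding : (G : Graph) → Bipartite G → ∀ {K} (La : ListAssignment G (suc K)) → nv G < 2 ^ K →
  (c₀ : Fin (n G) → ℕ) → (∀ v → c₀ v ∈ L La v) → ∃[ c ] IsLColoring La c × (∀ v → c v ≢ c₀ v)
coloring-avoiding G (side , bipartite) {K} La small c₀ c₀∈L = c , (proj₁ ∘ c∈L∖c₀ , proper) , proj₂ ∘ c∈L∖c₀
  where
  rest : Fin (n G) → List ℕ
  rest v = remove (c₀ v) (L La v)
  colors : List ℕ
  colors = concatMap (L La) (allFin (n G))
  rest-within : ∀ v → Maybe.All (Within colors) (just (rest v))
  rest-within v = just (Unique.filter⁺ _ (unique La v) , λ y∈rest →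
    ∈-concatMap⁺ (L La) (lose (∈-allFin v) (proj₁ (∈-remove⁻ y∈rest))))
  length-rest : ∀ v → length (rest v) ≡ K
  length-rest v = suc-injective (trans (sym (length-remove (unique La v) (c₀∈L v))) (size La v))
  weight-rest : ∀ v → weight K (just (rest v)) ≡ 1
  weight-rest v = cong (2 ^_) (trans (cong (K ∸_) (length-rest v)) (n∸n≡0 K))
  light : ∑[ v < n G ] weight K (just (rest v)) < 2 ^ K
  light = begin-strict
    ∑[ v < n G ] weight K (just (rest v)) ≡⟨ sum-cong-≗ weight-rest ⟩
    ∑[ v < n G ] 1                        ≡⟨ sum-const (n G) 1 ⟩
    n G * 1                               ≡⟨ *-identityʳ (n G) ⟩
    n G                                   <⟨ small ⟩
    2 ^ K                                 ∎
    where open ≤-Reasoning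
  hitting : ∃[ S ] ∀ v → Maybe.All (Hit S (side v)) (just (rest v))
  hitting = hitting-assignment K colors side (λ v → just (rest v)) rest-within light
  S : ℕ → Bool
  S = proj₁ hitting
  hit : ∀ v → Hit S (side v) (rest v)
  hit v = Maybe.drop-just (proj₂ hitting v)
  c : Fin (n G) → ℕ
  c v = proj₁ (hit v)
  c∈L∖c₀ : ∀ v → c v ∈ L La v × c v ≢ c₀ v
  c∈L∖c₀ v = ∈-remove⁻ {C = L La v} (proj₁ (proj₂ (hit v)))
  proper : ∀ u v → Adj G u v → c u ≢ c v
  proper u v uv cu≡cv =
    bipartite u v uv (trans (sym (proj₂ (proj₂ (hit u)))) (trans (cong S cu≡cv) (proj₂ (proj₂ (hit v)))))

bipartite-¬uniquely-colorable : (G : Graph) → Bipartite G → ∀ {K} → nv G < 2 ^ K →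
  ¬ UniquelyListColorable G (suc K)
bipartite-¬uniquely-colorable G bipartite small (La , c₀ , (c₀∈L , _) , unique-c₀) =
  let c , c-coloring , c≢c₀ = coloring-avoiding G bipartite La small c₀ c₀∈L
      v₀ = fromℕ< (n≥1 G)
  in c≢c₀ v₀ (unique-c₀ c c-coloring v₀)

theorem8 : (G : Graph) → Bipartite G → MNumberAtMost G (2 + ⌊log₂ nv G ⌋)
theorem8 G bipartite =
  2 + ⌊log₂ nv G ⌋ , s≤s z≤n , ≤-refl , bipartite-¬uniquely-colorable G bipartite (n<2^[1+⌊log₂n⌋] (nv G))
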